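{- Let $i\geq 1$ and $0\leq j\leq i$ be integers and let $G\in\mathcal{F}_{i,j}$. Then for every vertex $v\in V(G)$, $$\phi(G-v)\leq \frac{2|E(G)|-|V(G)|+2}{7}+\max\left\{\frac{5-i}{7},0\right\}-1.$$ In particular, for every $v\in V(G)$ there is a feedback vertex set $S$ of $G$ with $v\in S$ and $|S|\leq \frac{2|E(G)|-|V(G)|+2}{7}+\max\{\frac{5-i}{7},0\}$.
   Context: Graphs here may be multigraphs (loops and parallel edges allowed); a loop and a pair of parallel edges count as cycles. A feedback vertex set of $G$ is a set $S\subseteq V(G)$ such that $G-S$ has no cycle; $\phi(G)$ is its minimum size. For a multigraph $G$, edges $e_1,e_2\in E(G)$ (not necessarily distinct) and a vertex $a$ of degree two, $G\circ(e_1,e_2,a)$ is the multigraph obtained from $G$ by subdividing $e_1$ and $e_2$ once each (if $e_1=e_2$ this edge is subdivided twice) and adding a new vertex adjacent to $a$ and to the two new subdivision vertices. Define $\mathcal{F}_{1,0}$ to consist of the multigraph on one vertex with one loop, and $\mathcal{F}_{i,j}=\emptyset$ if $i\leq 0$ or $j<0$. For $0\leq j\leq i$ (other than $(i,j)=(1,0)$), $\mathcal{F}_{i,j}$ is the set of subcubic multigraphs (every vertex of degree at most three, loops counting twice) obtained either from a member of $\mathcal{F}_{i-1,j}$ by subdividing one edge once, or from a member of $\mathcal{F}_{i,j-1}$ by an operation $\circ$. -}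

module Defs where

open import Data.Nat using (ℕ; zero; suc; _+_; _*_; _∸_; _≤_)
open import Data.Fin using (Fin; zero; suc; inject₁; fromℕ; _≟_)
open import Data.Fin.Subset using (Subset; _∈_; _∉_)
open import Data.Product using (_×_; _,_; proj₁; proj₂; ∃)
open import Data.Sum using (_⊎_)
open import Data.List using (List; []; _∷_; map; length; lookup)
open import Data.Nat.ListAction using (sum)
open import Data.List.Relation.Binary.Permutation.Propositional using (_↭_)
open import Relation.Nullary using (¬_; does)
open import Relation.Binary.PropositionalEquality using (_≡_; _≢_)
open import Data.Bool using (if_then_else_)
open import Function.Definitions using (Injective)

-- Finite multigraphs: vertex set Fin n, edges a finite multiset (list)
-- of unordered pairs, each stored as an (arbitrarily oriented) pair.
-- A pair (a , a) is a loop; repeated pairs are parallel edges.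

record Multigraph : Set where
  constructor mg
  field
    n     : ℕ
    edges : List (Fin n × Fin n)
open Multigraph public

∣V∣ : Multigraph → ℕ
∣V∣ G = n G

∣E∣ : Multigraph → ℕ
∣E∣ G = length (edges G)

-- number of ends of edge e at v (a loop at v contributes 2)
ends : ∀ {n} → Fin n × Fin n → Fin n → ℕ
ends (a , b) v = (if does (a ≟ v) then 1 else 0) + (if does (b ≟ v) then 1 else 0)

deg : (G : Multigraph) → Fin (n G) → ℕ
deg G v = sum (map (λ e → ends e v) (edges G))

Subcubic : Multigraph → Set
Subcubic G = ∀ v → deg G v ≤ 3

Joins : ∀ {n} → Fin n × Fin n → Fin n → Fin n → Set
Joins (a , b) x y = (a ≡ x × b ≡ y) ⊎ (a ≡ y × b ≡ x)

-- Cycles: a closed walk w₀ e₀ w₁ e₁ … e_k w_{k+1} = w₀ of length k+1 ≥ 1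
-- with pairwise distinct vertices w₀ … w_k and pairwise distinct edges.
-- (Length 1: a loop; length 2: a pair of parallel edges.)

record Cycle (G : Multigraph) : Set where
  field
    k      : ℕ
    w      : Fin (suc (suc k)) → Fin (n G)
    e      : Fin (suc k) → Fin (length (edges G))
    closed : w zero ≡ w (fromℕ (suc k))
    w-inj  : Injective _≡_ _≡_ (λ i → w (inject₁ i))
    e-inj  : Injective _≡_ _≡_ e
    joins  : ∀ i → Joins (lookup (edges G) (e i)) (w (inject₁ i)) (w (suc i))
open Cycle public

cycleVertex : ∀ {G} → (c : Cycle G) → Fin (suc (k c)) → Fin (n G)
cycleVertex c i = w c (inject₁ i)

-- c is a cycle of the induced subgraph G - X  (X given as a predicate)
AvoidsP : ∀ {G} → Cycle G → (Fin (n G) → Set) → Set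
AvoidsP c X = ∀ i → ¬ X (cycleVertex c i)

IsFVS : (G : Multigraph) → Subset (n G) → Set
IsFVS G S = ∀ (c : Cycle G) → ¬ AvoidsP c (λ x → x ∈ S)

-- S ⊆ V(G - v) is a feedback vertex set of G - v
-- (cycles of G - v - S are the cycles of G avoiding S ∪ {v})
IsFVS-minus : (G : Multigraph) → Fin (n G) → Subset (n G) → Set
IsFVS-minus G v S =
  v ∉ S × (∀ (c : Cycle G) → ¬ AvoidsP c (λ x → x ∈ S ⊎ x ≡ v))

-- subdividing one edge once (new vertex = last vertex)
data Subdivision (G : Multigraph) : Multigraph → Set where
  subdivide : ∀ {p q rest} → edges G ↭ ((p , q) ∷ rest) →
    Subdivision G
      (mg (suc (n G))
          ((inject₁ p , fromℕ (n G)) ∷ (fromℕ (n G) , inject₁ q)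
             ∷ map (λ pq → inject₁ (proj₁ pq) , inject₁ (proj₂ pq)) rest))

module _ {m : ℕ} where
  L : Fin m → Fin (suc (suc (suc m)))
  L v = inject₁ (inject₁ (inject₁ v))

  Xv Yv Zv : Fin (suc (suc (suc m)))
  Xv = inject₁ (inject₁ (fromℕ m))
  Yv = inject₁ (fromℕ (suc m))
  Zv = fromℕ (suc (suc m))

  Lpair : Fin m × Fin m → Fin (suc (suc (suc m))) × Fin (suc (suc (suc m)))
  Lpair (a , b) = L a , L b

-- G ∘ (e₁ , e₂ , a): subdivision vertices x (on e₁), y (on e₂), new vertex z
data Circ (G : Multigraph) : Multigraph → Set where
  -- e₁ ≠ e₂ (two distinct, possibly parallel, edges)
  circ-distinct : ∀ {p₁ q₁ p₂ q₂ rest} (a : Fin (n G)) → deg G a ≡ 2 →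
    edges G ↭ ((p₁ , q₁) ∷ (p₂ , q₂) ∷ rest) →
    Circ G
      (mg (suc (suc (suc (n G))))
          ((L p₁ , Xv) ∷ (Xv , L q₁) ∷ (L p₂ , Yv) ∷ (Yv , L q₂)
            ∷ (Zv , L a) ∷ (Zv , Xv) ∷ (Zv , Yv) ∷ map Lpair rest))
  -- e₁ = e₂ (the edge is subdivided twice)
  circ-same : ∀ {p q rest} (a : Fin (n G)) → deg G a ≡ 2 →
    edges G ↭ ((p , q) ∷ rest) →
    Circ G
      (mg (suc (suc (suc (n G))))
          ((L p , Xv) ∷ (Xv , Yv) ∷ (Yv , L q)
            ∷ (Zv , L a) ∷ (Zv , Xv) ∷ (Zv , Yv) ∷ map Lpair rest))

loopGraph : Multigraph
loopGraph = mg 1 ((zero , zero) ∷ [])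

data F : ℕ → ℕ → Multigraph → Set where
  F-base : F 1 0 loopGraph
  F-sub  : ∀ {i j G H} → F i j G → j ≤ suc i →
           Subdivision G H → Subcubic H → F (suc i) j H
  F-circ : ∀ {i j G H} → F i j G → suc j ≤ i →
           Circ G H → Subcubic H → F i (suc j) H

module Submission where

-- A feedback vertex set is certified by a ranking of the vertices: the vertices
-- of rank 0 are deleted, and every other vertex may have at most one edge end
-- pointing to a neighbour of equal or larger rank.  Such certificates extend
-- along subdivisions (after doubling all ranks, the new vertex gets a rank
-- strictly between those of its two neighbours), along adding a deleted vertex,
-- and along adding a pendant vertex of rank 1.
--
-- With K = 2 + max(5 - i, 0) one proves by induction on F i j that every vertex
-- lies in a feedback vertex set S with 7|S| + |V| ≤ 2|E| + K, and that after
-- removing any edge there is one with 7(|S| + 1) + |V| ≤ 2|E| + K.  A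
-- subdivision adds one unit of slack.  G ∘ (e₁, e₂, a) is two subdivisions
-- followed by attaching a vertex z to a, x and y, which costs two units: z joins
-- the set, except when a z-edge is removed; then z hangs from one remaining
-- neighbour, and its edge to the other is dead because the set is chosen
-- through that other neighbour.

open import Defs
open import Data.Bool.Base using (if_then_else_)
open import Data.Fin.Base using (Fin; zero; suc; inject₁; fromℕ; toℕ)
open import Data.Fin.Properties using (_≟_; inject₁-injective; fromℕ≢inject₁; toℕ-inject₁)
open import Data.Fin.Subset using (Subset; ∣_∣; _∈_; _∉_; _-_)
open import Data.Fin.Subset.Properties using (x∈p∧x≢y⇒x∈p-y; x∈p⇒∣p-x∣<∣p∣)
open import Data.List.Base using (List; []; _∷_; _++_; map; length; lookup)
open import Data.List.Properties using (map-++; length-map)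
open import Data.List.Membership.Propositional using () renaming (_∈_ to _∈ₗ_)
open import Data.List.Membership.Propositional.Properties using (∈-map⁻; ∈-∃++)
open import Data.List.Relation.Unary.All using (All; []; _∷_)
open import Data.List.Relation.Unary.Any using (here; there)
open import Data.List.Relation.Binary.Permutation.Propositional
  using (_↭_; ↭-refl; ↭-reflexive; ↭-sym; ↭-trans; prep; swap)
import Data.List.Relation.Binary.Permutation.Propositional.Properties as ↭
open import Data.Nat.Base using (ℕ; zero; suc; _+_; _*_; _∸_; _⊓_; _≤_; z≤n; s≤s)
open import Data.Nat.ListAction using (sum)
open import Data.Nat.ListAction.Properties using (sum-++; sum-↭)
open import Data.Nat.Properties hiding (_≟_)
open import Data.Nat.Properties using () renaming (_≟_ to _≟ℕ_)
open import Data.Nat.Tactic.RingSolver using (solve-∀)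
open import Data.Product.Base using (_×_; _,_; ∃; proj₁; proj₂)
open import Data.Product.Function.NonDependent.Propositional using (_×-⇔_)
open import Data.Sum.Base using (_⊎_; inj₁; inj₂) renaming (swap to ⊎-swap)
open import Data.Vec.Base using (tabulate; _∷_; there)
open import Data.Vec.Properties using (tabulate-cong; lookup∘tabulate; lookup⇒[]=)
open import Function.Base using (_∘_)
open import Function.Bundles using (_⇔_; mk⇔)
open import Function.Definitions using (Injective)
open import Relation.Binary.PropositionalEquality
open import Relation.Nullary.Decidable using (Dec; does; yes; no; _×-dec_; dec-true; dec-false; does-⇔)
open import Relation.Nullary.Negation using (¬_; contradiction)

private variable
  A B : Set
  m ℓ : ℕ

𝟙 : Dec A → ℕ
𝟙 a? = if does a? then 1 else 0

𝟙≤1 : (a? : Dec A) → 𝟙 a? ≤ 1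
𝟙≤1 (yes _) = ≤-refl
𝟙≤1 (no _)  = z≤n

𝟙-yes : (a? : Dec A) → A → 𝟙 a? ≡ 1
𝟙-yes a? a = cong (if_then 1 else 0) (dec-true a? a)

𝟙-no : (a? : Dec A) → ¬ A → 𝟙 a? ≡ 0
𝟙-no a? ¬a = cong (if_then 1 else 0) (dec-false a? ¬a)

𝟙-⇔ : A ⇔ B → (a? : Dec A) (b? : Dec B) → 𝟙 a? ≡ 𝟙 b?
𝟙-⇔ A⇔B a? b? = cong (if_then 1 else 0) (does-⇔ A⇔B a? b?)

𝟙-mono : (A → B) → (a? : Dec A) (b? : Dec B) → 𝟙 a? ≤ 𝟙 b?
𝟙-mono A→B (no _)  b?      = z≤n
𝟙-mono A→B (yes _) (yes _) = ≤-refl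
𝟙-mono A→B (yes a) (no ¬b) = contradiction (A→B a) ¬b

𝟙+𝟙≤1 : ¬ (A × B) → (a? : Dec A) (b? : Dec B) → 𝟙 a? + 𝟙 b? ≤ 1
𝟙+𝟙≤1 ¬ab (yes a) (yes b) = contradiction (a , b) ¬ab
𝟙+𝟙≤1 ¬ab (yes _) (no _)  = ≤-refl
𝟙+𝟙≤1 ¬ab (no _)  b?      = 𝟙≤1 b?

∣does∷∣ : (a? : Dec A) (p : Subset m) → ∣ does a? ∷ p ∣ ≡ 𝟙 a? + ∣ p ∣
∣does∷∣ (yes _) p = refl
∣does∷∣ (no _)  p = refl

lookup≤sum-map : (f : A → ℕ) (xs : List A) (i : Fin (length xs)) →
                 f (lookup xs i) ≤ sum (map f xs)
lookup≤sum-map f (x ∷ xs) zero    = m≤m+n (f x) _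
lookup≤sum-map f (x ∷ xs) (suc i) = ≤-trans (lookup≤sum-map f xs i) (m≤n+m _ (f x))

lookup+lookup≤sum-map : (f : A → ℕ) (xs : List A) {i j : Fin (length xs)} → i ≢ j →
                        f (lookup xs i) + f (lookup xs j) ≤ sum (map f xs)
lookup+lookup≤sum-map f (x ∷ xs) {zero}  {zero}  i≢j = contradiction refl i≢j
lookup+lookup≤sum-map f (x ∷ xs) {zero}  {suc j} _   = +-monoʳ-≤ (f x) (lookup≤sum-map f xs j)
lookup+lookup≤sum-map f (x ∷ xs) {suc i} {zero}  _   =
  ≤-trans (≤-reflexive (+-comm _ (f x))) (+-monoʳ-≤ (f x) (lookup≤sum-map f xs i))
lookup+lookup≤sum-map f (x ∷ xs) {suc i} {suc j} i≢j =
  ≤-trans (lookup+lookup≤sum-map f xs (i≢j ∘ cong suc)) (m≤n+m _ (f x))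

∃-minimum : (f : Fin (suc ℓ) → ℕ) → ∃ λ i → ∀ j → f i ≤ f j
∃-minimum {zero}  f = zero , λ { zero → ≤-refl }
∃-minimum {suc ℓ} f with ∃-minimum (f ∘ suc)
... | i , min with f zero ≤? f (suc i)
...   | yes f0≤ = zero , λ { zero → ≤-refl ; (suc j) → ≤-trans f0≤ (min j) }
...   | no  f0≰ = suc i , λ { zero → <⇒≤ (≰⇒> f0≰) ; (suc j) → min j }

data LastView : Fin (suc m) → Set where
  old : (u : Fin m) → LastView (inject₁ u)
  new : LastView (fromℕ m)

lastView : (i : Fin (suc m)) → LastView i
lastView {zero}  zero    = new
lastView {suc m} zero    = old zero
lastView {suc m} (suc i) with lastView i
... | old u = old (suc u)
... | new   = new

inject₁≢suc : (i : Fin m) → inject₁ i ≢ suc i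
inject₁≢suc i eq = 1+n≢n (trans (cong toℕ (sym eq)) (toℕ-inject₁ i))

m∸n≤1+m∸1+n : ∀ m n → m ∸ n ≤ suc (m ∸ suc n)
m∸n≤1+m∸1+n zero    zero    = z≤n
m∸n≤1+m∸1+n zero    (suc n) = z≤n
m∸n≤1+m∸1+n (suc m) zero    = ≤-refl
m∸n≤1+m∸1+n (suc m) (suc n) = m∸n≤1+m∸1+n m n

x∉p-x : (p : Subset m) (x : Fin m) → x ∉ p - x
x∉p-x (_ ∷ p) zero    ()
x∉p-x (_ ∷ p) (suc x) (there x∈p-x) = x∉p-x p x x∈p-x

every-removal : {P : List A → Set} → (∀ {xs ys} → xs ↭ ys → P xs → P ys) → {es : List A} →
                (∀ {e} → e ∈ₗ es → ∃ λ rest → es ↭ e ∷ rest × P rest) →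
                ∀ {e rest} → es ↭ e ∷ rest → P rest
every-removal P-↭ members es↭ with members (↭.∈-resp-↭ (↭-sym es↭) (here refl))
... | rest′ , es↭′ , P-rest′ = P-↭ (↭.drop-∷ (↭-trans (↭-sym es↭′) es↭)) P-rest′

∈⇒↭-∷ : {x : A} {xs : List A} → x ∈ₗ xs → ∃ λ ys → xs ↭ x ∷ ys
∈⇒↭-∷ {x = x} x∈xs with ys , zs , refl ← ∈-∃++ x∈xs = ys ++ zs , ↭.shift x ys zs

reverse-blocks : (xs ys zs ws : List A) → zs ++ ys ++ xs ++ ws ↭ xs ++ ys ++ zs ++ ws
reverse-blocks xs ys zs ws =
  ↭-trans (↭.shifts zs ys) (↭-trans (↭.++⁺ˡ ys (↭.shifts zs xs)) (↭.shifts ys xs))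

Ranking : ℕ → Set
Ranking m = Fin m → ℕ

Edge : ℕ → Set
Edge m = Fin m × Fin m

UpEnd : Ranking m → Fin m → Fin m → Fin m → Set
UpEnd r v a b = a ≡ v × r v ≤ r b

upEnd? : (r : Ranking m) (v a b : Fin m) → Dec (UpEnd r v a b)
upEnd? r v a b = (a ≟ v) ×-dec (r v ≤? r b)

upEnds : Ranking m → Edge m → Fin m → ℕ
upEnds r (a , b) v = 𝟙 (upEnd? r v a b) + 𝟙 (upEnd? r v b a)

upDegree : Ranking m → List (Edge m) → Fin m → ℕ
upDegree r es v = sum (map (λ e → upEnds r e v) es)

-- The vertices of rank 0 form a feedback vertex set: on a cycle avoiding them,
-- a vertex of minimum rank would have two upward edge ends.
record ForestRanking (es : List (Edge m)) (r : Ranking m) : Set where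
  constructor forestRanking
  field upDegree≤1 : ∀ v → r v ≢ 0 → upDegree r es v ≤ 1
open ForestRanking public

upEnds-joins : (r : Ranking m) {e : Edge m} {v x : Fin m} →
               Joins e v x → r v ≤ r x → 1 ≤ upEnds r e v
upEnds-joins r {a , b} (inj₁ (refl , refl)) rv≤rx =
  ≤-trans (≤-reflexive (sym (𝟙-yes (upEnd? r a a b) (refl , rv≤rx)))) (m≤m+n _ _)
upEnds-joins r {a , b} (inj₂ (refl , refl)) rv≤rx =
  ≤-trans (≤-reflexive (sym (𝟙-yes (upEnd? r b b a) (refl , rv≤rx)))) (m≤n+m _ _)

loop-ends : (r : Ranking m) (a : Fin m) → upEnds r (a , a) a ≡ 2
loop-ends r a = cong₂ _+_ up up
  where up = 𝟙-yes (upEnd? r a a a) (refl , ≤-refl)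

upEnds-loop : (r : Ranking m) {e : Edge m} {v : Fin m} → Joins e v v → 2 ≤ upEnds r e v
upEnds-loop r {a , _} (inj₁ (refl , refl)) = ≤-reflexive (sym (loop-ends r a))
upEnds-loop r {a , _} (inj₂ (refl , refl)) = ≤-reflexive (sym (loop-ends r a))

module _ {es : List (Edge m)} {r : Ranking m} (forest : ForestRanking es r) where

  upDegree≥2⇒rank0 : ∀ {v} → 2 ≤ upDegree r es v → r v ≡ 0
  upDegree≥2⇒rank0 {v} two with r v ≟ℕ 0
  ... | yes rv≡0 = rv≡0
  ... | no  rv≢0 = contradiction (≤-trans two (upDegree≤1 forest v rv≢0)) (1+n≰n {1})

  closedWalk-meets-rank0 :
    (w : Fin (suc (suc ℓ)) → Fin m) (e : Fin (suc ℓ) → Fin (length es)) →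
    w zero ≡ w (fromℕ (suc ℓ)) → Injective _≡_ _≡_ e →
    (∀ i → Joins (lookup es (e i)) (w (inject₁ i)) (w (suc i))) →
    ¬ (∀ i → r (w (inject₁ i)) ≢ 0)
  closedWalk-meets-rank0 {zero} w e closed e-inj joins positive =
    positive zero (upDegree≥2⇒rank0 (≤-trans (upEnds-loop r loop) (lookup≤sum-map _ es (e zero))))
    where
    loop : Joins (lookup es (e zero)) (w zero) (w zero)
    loop = subst (Joins (lookup es (e zero)) (w zero)) (sym closed) (joins zero)
  closedWalk-meets-rank0 {suc ℓ} w e closed e-inj joins positive
    with ∃-minimum (λ i → r (w (inject₁ i)))
  ... | k , minimal = positive k (at-minimum k minimal)
    where
    Minimal : Fin (suc (suc ℓ)) → Set
    Minimal k = ∀ i → r (w (inject₁ k)) ≤ r (w (inject₁ i))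

    minimal-everywhere : ∀ {k} → Minimal k → ∀ j → r (w (inject₁ k)) ≤ r (w j)
    minimal-everywhere {k} min j with lastView j
    ... | old i = min i
    ... | new   = subst (λ x → r (w (inject₁ k)) ≤ r x) closed (min zero)

    two-upward : ∀ {v x y} {i j : Fin (suc (suc ℓ))} → i ≢ j →
                 Joins (lookup es (e i)) v x → Joins (lookup es (e j)) y v →
                 r v ≤ r x → r v ≤ r y → r v ≡ 0
    two-upward {v} i≢j ei ej rv≤rx rv≤ry = upDegree≥2⇒rank0
      (≤-trans (+-mono-≤ (upEnds-joins r ei rv≤rx) (upEnds-joins r (⊎-swap ej) rv≤ry))
               (lookup+lookup≤sum-map (λ e → upEnds r e v) es (i≢j ∘ e-inj)))

    at-minimum : ∀ k → Minimal k → r (w (inject₁ k)) ≡ 0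
    at-minimum zero min = two-upward {i = zero} {fromℕ (suc ℓ)} (λ ())
      (joins zero) (subst (Joins _ _) (sym closed) (joins (fromℕ (suc ℓ))))
      (minimal-everywhere min _) (minimal-everywhere min _)
    at-minimum (suc k) min = two-upward {i = suc k} {inject₁ k} (inject₁≢suc k ∘ sym)
      (joins (suc k)) (joins (inject₁ k))
      (minimal-everywhere min _) (minimal-everywhere min _)

cycle-meets-rank0 : {G : Multigraph} {r : Ranking (n G)} → ForestRanking (edges G) r →
                    (c : Cycle G) → ¬ (∀ i → r (cycleVertex c i) ≢ 0)
cycle-meets-rank0 {G} forest c =
  closedWalk-meets-rank0 {es = edges G} forest (w c) (e c) (closed c) (e-inj c) (joins c)

upDegree-++ : (r : Ranking m) (xs ys : List (Edge m)) (v : Fin m) →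
              upDegree r (xs ++ ys) v ≡ upDegree r xs v + upDegree r ys v
upDegree-++ r xs ys v = trans (cong sum (map-++ _ xs ys)) (sum-++ (map _ xs) _)

forest-↭ : {xs ys : List (Edge m)} {r : Ranking m} → xs ↭ ys → ForestRanking xs r → ForestRanking ys r
forest-↭ {r = r} xs↭ys forest = forestRanking λ v rv≢0 →
  subst (_≤ 1) (sum-↭ (↭.map⁺ (λ e → upEnds r e v) xs↭ys)) (upDegree≤1 forest v rv≢0)

forest-flip : ∀ {a b} {M : List (Edge m)} {r : Ranking m} →
              ForestRanking ((b , a) ∷ M) r → ForestRanking ((a , b) ∷ M) r
forest-flip {a = a} {b} {M} {r} forest = forestRanking λ v rv≢0 →
  subst (_≤ 1) (cong (_+ upDegree r M v) (+-comm (𝟙 (upEnd? r v b a)) _)) (upDegree≤1 forest v rv≢0)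

Dead : Ranking m → Edge m → Set
Dead r (a , b) = r a ≡ 0 ⊎ r b ≡ 0

¬upEnd-dead : (r : Ranking m) {v a b : Fin m} → r v ≢ 0 → Dead r (a , b) → ¬ UpEnd r v a b
¬upEnd-dead r rv≢0 (inj₁ ra≡0) (refl , _)    = rv≢0 ra≡0
¬upEnd-dead r {v} rv≢0 (inj₂ rb≡0) (_ , rv≤rb) = rv≢0 (n≤0⇒n≡0 (subst (r v ≤_) rb≡0 rv≤rb))

upDegree-dead : (r : Ranking m) {v : Fin m} {N : List (Edge m)} → r v ≢ 0 → All (Dead r) N →
                upDegree r N v ≡ 0
upDegree-dead r rv≢0 [] = refl
upDegree-dead r {v} {(a , b) ∷ _} rv≢0 (dead ∷ deads) = cong₂ _+_
  (cong₂ _+_ (𝟙-no (upEnd? r v a b) (¬upEnd-dead r rv≢0 dead))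
             (𝟙-no (upEnd? r v b a) (¬upEnd-dead r rv≢0 (⊎-swap dead))))
  (upDegree-dead r rv≢0 deads)

extend : Ranking m → ℕ → Ranking (suc m)
extend {zero}  r t zero    = t
extend {suc m} r t zero    = r zero
extend {suc m} r t (suc i) = extend (r ∘ suc) t i

extend-inject₁ : (r : Ranking m) (t : ℕ) (u : Fin m) → extend r t (inject₁ u) ≡ r u
extend-inject₁ {suc m} r t zero    = refl
extend-inject₁ {suc m} r t (suc u) = extend-inject₁ (r ∘ suc) t u

extend-fromℕ : (r : Ranking m) (t : ℕ) → extend r t (fromℕ m) ≡ t
extend-fromℕ {zero}  r t = refl
extend-fromℕ {suc m} r t = extend-fromℕ (r ∘ suc) t

grow : Ranking m → ℕ → Ranking (suc m)
grow r = extend (λ u → 2 * r u)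

grow-old : (r : Ranking m) (t : ℕ) (u : Fin m) → grow r t (inject₁ u) ≡ 2 * r u
grow-old r = extend-inject₁ (λ u → 2 * r u)

grow-new : (r : Ranking m) (t : ℕ) → grow r t (fromℕ m) ≡ t
grow-new r = extend-fromℕ (λ u → 2 * r u)

grow-old≢0 : (r : Ranking m) (t : ℕ) {u : Fin m} → r u ≢ 0 → grow r t (inject₁ u) ≢ 0
grow-old≢0 r t {u} ru≢0 eq = ru≢0 (*-cancelˡ-≡ (r u) 0 2 (trans (sym (grow-old r t u)) eq))

grow-old-≤ : (r : Ranking m) (t : ℕ) (u v : Fin m) →
             grow r t (inject₁ u) ≤ grow r t (inject₁ v) ⇔ r u ≤ r v
grow-old-≤ r t u v rewrite grow-old r t u | grow-old r t v = mk⇔ (*-cancelˡ-≤ 2) (*-monoʳ-≤ 2)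

liftEdge : Edge m → Edge (suc m)
liftEdge e = inject₁ (proj₁ e) , inject₁ (proj₂ e)

¬upEnd-new-at-old : (r : Ranking (suc m)) {u : Fin m} {b : Fin (suc m)} → ¬ UpEnd r (inject₁ u) (fromℕ m) b
¬upEnd-new-at-old r (eq , _) = fromℕ≢inject₁ eq

¬upEnd-old-at-new : (r : Ranking (suc m)) {a : Fin m} {b : Fin (suc m)} → ¬ UpEnd r (fromℕ m) (inject₁ a) b
¬upEnd-old-at-new r (eq , _) = fromℕ≢inject₁ (sym eq)

upEnds-lift-old : (r : Ranking m) (t : ℕ) (e : Edge m) (u : Fin m) →
                  upEnds (grow r t) (liftEdge e) (inject₁ u) ≡ upEnds r e u
upEnds-lift-old r t (a , b) u = cong₂ _+_
  (𝟙-⇔ (lifted a b) (upEnd? (grow r t) (inject₁ u) (inject₁ a) (inject₁ b)) (upEnd? r u a b))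
  (𝟙-⇔ (lifted b a) (upEnd? (grow r t) (inject₁ u) (inject₁ b) (inject₁ a)) (upEnd? r u b a))
  where
  lifted : ∀ a b → UpEnd (grow r t) (inject₁ u) (inject₁ a) (inject₁ b) ⇔ UpEnd r u a b
  lifted a b = mk⇔ inject₁-injective (cong inject₁) ×-⇔ grow-old-≤ r t u b

upEnds-lift-new : (r : Ranking m) (t : ℕ) (e : Edge m) →
                  upEnds (grow r t) (liftEdge e) (fromℕ m) ≡ 0
upEnds-lift-new {m} r t (a , b) = cong₂ _+_
  (𝟙-no (upEnd? (grow r t) (fromℕ m) (inject₁ a) (inject₁ b)) (¬upEnd-old-at-new (grow r t)))
  (𝟙-no (upEnd? (grow r t) (fromℕ m) (inject₁ b) (inject₁ a)) (¬upEnd-old-at-new (grow r t)))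

upDegree-lift-old : (r : Ranking m) (t : ℕ) (M : List (Edge m)) (u : Fin m) →
                    upDegree (grow r t) (map liftEdge M) (inject₁ u) ≡ upDegree r M u
upDegree-lift-old r t []      u = refl
upDegree-lift-old r t (e ∷ M) u = cong₂ _+_ (upEnds-lift-old r t e u) (upDegree-lift-old r t M u)

upDegree-lift-new : (r : Ranking m) (t : ℕ) (M : List (Edge m)) →
                    upDegree (grow r t) (map liftEdge M) (fromℕ m) ≡ 0
upDegree-lift-new r t []      = refl
upDegree-lift-new r t (e ∷ M) = cong₂ _+_ (upEnds-lift-new r t e) (upDegree-lift-new r t M)

forest-grow : (r : Ranking m) (t : ℕ) (N : List (Edge (suc m))) (M : List (Edge m)) →
  (∀ u → r u ≢ 0 → upDegree (grow r t) N (inject₁ u) + upDegree r M u ≤ 1) →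
  (t ≢ 0 → upDegree (grow r t) N (fromℕ m) ≤ 1) →
  ForestRanking (N ++ map liftEdge M) (grow r t)
forest-grow r t N M old-ok new-ok = forestRanking at
  where
  at : ∀ v → grow r t v ≢ 0 → upDegree (grow r t) (N ++ map liftEdge M) v ≤ 1
  at v rv≢0 with lastView v
  ... | old u = begin
    upDegree (grow r t) (N ++ map liftEdge M) (inject₁ u)
      ≡⟨ upDegree-++ (grow r t) N _ (inject₁ u) ⟩
    upDegree (grow r t) N (inject₁ u) + upDegree (grow r t) (map liftEdge M) (inject₁ u)
      ≡⟨ cong (upDegree (grow r t) N (inject₁ u) +_) (upDegree-lift-old r t M u) ⟩
    upDegree (grow r t) N (inject₁ u) + upDegree r M u
      ≤⟨ old-ok u (λ ru≡0 → rv≢0 (trans (grow-old r t u) (cong (2 *_) ru≡0))) ⟩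
    1 ∎
    where open ≤-Reasoning
  ... | new = begin
    upDegree (grow r t) (N ++ map liftEdge M) (fromℕ _)
      ≡⟨ upDegree-++ (grow r t) N _ (fromℕ _) ⟩
    upDegree (grow r t) N (fromℕ _) + upDegree (grow r t) (map liftEdge M) (fromℕ _)
      ≡⟨ cong (upDegree (grow r t) N (fromℕ _) +_) (upDegree-lift-new r t M) ⟩
    upDegree (grow r t) N (fromℕ _) + 0
      ≡⟨ +-identityʳ _ ⟩
    upDegree (grow r t) N (fromℕ _)
      ≤⟨ new-ok (λ t≡0 → rv≢0 (trans (grow-new r t) t≡0)) ⟩
    1 ∎
    where open ≤-Reasoning

midRank : ℕ → ℕ → ℕ
midRank a b = suc (2 * (a ⊓ b))

2*m≤1+2*n⇒m≤n : ∀ {a b} → 2 * a ≤ suc (2 * b) → a ≤ b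
2*m≤1+2*n⇒m≤n {a} {b} h with a ≤? b
... | yes a≤b = a≤b
... | no  a≰b = contradiction
  (≤-trans (≤-reflexive (sym (*-suc 2 b))) (≤-trans (*-monoʳ-≤ 2 (≰⇒> a≰b)) h))
  (1+n≰n {suc (2 * b)})

2*-≤-midRank⇒≤ : ∀ {a b} → 2 * a ≤ midRank a b → a ≤ b
2*-≤-midRank⇒≤ {a} {b} h = ≤-trans (2*m≤1+2*n⇒m≤n h) (m⊓n≤n a b)

2*-≤-midRank⇒≥ : ∀ {a b} → 2 * b ≤ midRank a b → b ≤ a
2*-≤-midRank⇒≥ {a} {b} h = ≤-trans (2*m≤1+2*n⇒m≤n h) (m⊓n≤m a b)

midRank-≰-both : ∀ {a b} → ¬ (midRank a b ≤ 2 * a × midRank a b ≤ 2 * b)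
midRank-≰-both {a} {b} (≤2a , ≤2b) with ⊓-sel a b
... | inj₁ a⊓b≡a = 1+n≰n (subst (λ c → suc (2 * c) ≤ 2 * a) a⊓b≡a ≤2a)
... | inj₂ a⊓b≡b = 1+n≰n (subst (λ c → suc (2 * c) ≤ 2 * b) a⊓b≡b ≤2b)

splitEdges : Fin m → Fin m → List (Edge (suc m))
splitEdges {m} p q = (inject₁ p , fromℕ m) ∷ (fromℕ m , inject₁ q) ∷ []

subdivision : Fin m → Fin m → List (Edge m) → List (Edge (suc m))
subdivision p q M = splitEdges p q ++ map liftEdge M

upDegree-split-old : (r : Ranking m) (p q u : Fin m) →
  upDegree (grow r (midRank (r p) (r q))) (splitEdges p q) (inject₁ u) ≤ upEnds r (p , q) u
upDegree-split-old {m} r p q u = begin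
  (𝟙 P + 𝟙 (upEnd? r′ (inject₁ u) s (inject₁ p)))
    + ((𝟙 (upEnd? r′ (inject₁ u) s (inject₁ q)) + 𝟙 Q) + 0)
    ≡⟨ cong₂ (λ x y → (𝟙 P + x) + ((y + 𝟙 Q) + 0))
             (𝟙-no (upEnd? r′ (inject₁ u) s (inject₁ p)) (¬upEnd-new-at-old r′))
             (𝟙-no (upEnd? r′ (inject₁ u) s (inject₁ q)) (¬upEnd-new-at-old r′)) ⟩
  (𝟙 P + 0) + ((0 + 𝟙 Q) + 0)
    ≡⟨ cong₂ _+_ (+-identityʳ (𝟙 P)) (+-identityʳ (𝟙 Q)) ⟩
  𝟙 P + 𝟙 Q
    ≤⟨ +-mono-≤ (𝟙-mono from-p P (upEnd? r u p q)) (𝟙-mono from-q Q (upEnd? r u q p)) ⟩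
  upEnds r (p , q) u ∎
  where
  open ≤-Reasoning
  t = midRank (r p) (r q)
  r′ = grow r t
  s = fromℕ m
  P = upEnd? r′ (inject₁ u) (inject₁ p) s
  Q = upEnd? r′ (inject₁ u) (inject₁ q) s

  from-p : UpEnd r′ (inject₁ u) (inject₁ p) s → UpEnd r u p q
  from-p (eq , le) with refl ← inject₁-injective eq =
    refl , 2*-≤-midRank⇒≤ (subst₂ _≤_ (grow-old r t p) (grow-new r t) le)

  from-q : UpEnd r′ (inject₁ u) (inject₁ q) s → UpEnd r u q p
  from-q (eq , le) with refl ← inject₁-injective eq =
    refl , 2*-≤-midRank⇒≥ (subst₂ _≤_ (grow-old r t q) (grow-new r t) le)

upDegree-split-new : (r : Ranking m) (p q : Fin m) →
  upDegree (grow r (midRank (r p) (r q))) (splitEdges p q) (fromℕ m) ≤ 1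
upDegree-split-new {m} r p q = begin
  (𝟙 (upEnd? r′ s (inject₁ p) s) + 𝟙 P) + ((𝟙 Q + 𝟙 (upEnd? r′ s (inject₁ q) s)) + 0)
    ≡⟨ cong₂ (λ x y → (x + 𝟙 P) + ((𝟙 Q + y) + 0))
             (𝟙-no (upEnd? r′ s (inject₁ p) s) (¬upEnd-old-at-new r′))
             (𝟙-no (upEnd? r′ s (inject₁ q) s) (¬upEnd-old-at-new r′)) ⟩
  𝟙 P + ((𝟙 Q + 0) + 0)
    ≡⟨ cong (𝟙 P +_) (trans (+-identityʳ (𝟙 Q + 0)) (+-identityʳ (𝟙 Q))) ⟩
  𝟙 P + 𝟙 Q
    ≤⟨ 𝟙+𝟙≤1 (λ ((_ , t≤p) , (_ , t≤q)) → midRank-≰-both {r p} {r q}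
                (subst₂ _≤_ (grow-new r t) (grow-old r t p) t≤p ,
                 subst₂ _≤_ (grow-new r t) (grow-old r t q) t≤q)) P Q ⟩
  1 ∎
  where
  open ≤-Reasoning
  t = midRank (r p) (r q)
  r′ = grow r t
  s = fromℕ m
  P = upEnd? r′ s s (inject₁ p)
  Q = upEnd? r′ s s (inject₁ q)

forest-subdivide : {r : Ranking m} {p q : Fin m} {M : List (Edge m)} → ForestRanking ((p , q) ∷ M) r →
                   ForestRanking (subdivision p q M) (grow r (midRank (r p) (r q)))
forest-subdivide {r = r} {p} {q} {M} forest = forest-grow r _ (splitEdges p q) M
  (λ u ru≢0 → ≤-trans (+-monoˡ-≤ (upDegree r M u) (upDegree-split-old r p q u))
                      (upDegree≤1 forest u ru≢0))
  (λ _ → upDegree-split-new r p q)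

forest-addDeleted : {r : Ranking m} {M : List (Edge m)} → ForestRanking M r →
                    (N : List (Edge (suc m))) → All (Dead (grow r 0)) N →
                    ForestRanking (N ++ map liftEdge M) (grow r 0)
forest-addDeleted {r = r} {M} forest N deads = forest-grow r 0 N M old-ok (λ 0≢0 → contradiction refl 0≢0)
  where
  old-ok : ∀ u → r u ≢ 0 → upDegree (grow r 0) N (inject₁ u) + upDegree r M u ≤ 1
  old-ok u ru≢0 rewrite upDegree-dead (grow r 0) (grow-old≢0 r 0 ru≢0) deads = upDegree≤1 forest u ru≢0

forest-addPendant : {r : Ranking m} {M : List (Edge m)} → ForestRanking M r →
                    (q : Fin m) (D : List (Edge (suc m))) → All (Dead (grow r 1)) D →
                    ForestRanking ((fromℕ m , inject₁ q) ∷ D ++ map liftEdge M) (grow r 1)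
forest-addPendant {m} {r} {M} forest q D deads = forest-grow r 1 ((s , inject₁ q) ∷ D) M old-ok new-ok
  where
  r′ = grow r 1
  s = fromℕ m

  ¬up-to-pendant : ∀ {u a} → r u ≢ 0 → ¬ UpEnd r′ (inject₁ u) a s
  ¬up-to-pendant {u} ru≢0 (_ , le) = contradiction
    (≤-trans (*-monoʳ-≤ 2 (n≢0⇒n>0 ru≢0)) (subst₂ _≤_ (grow-old r 1 u) (grow-new r 1) le))
    (1+n≰n {1})

  old-ok : ∀ u → r u ≢ 0 → upDegree r′ ((s , inject₁ q) ∷ D) (inject₁ u) + upDegree r M u ≤ 1
  old-ok u ru≢0
    rewrite upDegree-dead r′ (grow-old≢0 r 1 ru≢0) deads
          | 𝟙-no (upEnd? r′ (inject₁ u) s (inject₁ q)) (¬upEnd-new-at-old r′)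
          | 𝟙-no (upEnd? r′ (inject₁ u) (inject₁ q) s) (¬up-to-pendant ru≢0)
          = upDegree≤1 forest u ru≢0

  new-ok : 1 ≢ 0 → upDegree r′ ((s , inject₁ q) ∷ D) s ≤ 1
  new-ok 1≢0
    rewrite upDegree-dead r′ (λ eq → 1≢0 (trans (sym (grow-new r 1)) eq)) deads
          | 𝟙-no (upEnd? r′ s (inject₁ q) s) (¬upEnd-old-at-new r′)
          = ≤-trans (≤-reflexive (trans (+-identityʳ _) (+-identityʳ _)))
                    (𝟙≤1 (upEnd? r′ s s (inject₁ q)))

zeroSet : Ranking m → Subset m
zeroSet r = tabulate (λ u → does (r u ≟ℕ 0))

rank0⇒∈zeroSet : (r : Ranking m) {u : Fin m} → r u ≡ 0 → u ∈ zeroSet r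
rank0⇒∈zeroSet r {u} ru≡0 =
  lookup⇒[]= u (zeroSet r) (trans (lookup∘tabulate _ u) (dec-true (r u ≟ℕ 0) ru≡0))

∣zeroSet-extend∣ : (r : Ranking m) (t : ℕ) →
                   ∣ zeroSet (extend r t) ∣ ≡ ∣ zeroSet r ∣ + 𝟙 (t ≟ℕ 0)
∣zeroSet-extend∣ {zero}  r t = trans (∣does∷∣ (t ≟ℕ 0) (zeroSet r)) (+-identityʳ (𝟙 (t ≟ℕ 0)))
∣zeroSet-extend∣ {suc m} r t = begin
  ∣ zeroSet (extend r t) ∣
    ≡⟨ ∣does∷∣ (r zero ≟ℕ 0) (zeroSet (extend (r ∘ suc) t)) ⟩
  𝟙 (r zero ≟ℕ 0) + ∣ zeroSet (extend (r ∘ suc) t) ∣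
    ≡⟨ cong (𝟙 (r zero ≟ℕ 0) +_) (∣zeroSet-extend∣ (r ∘ suc) t) ⟩
  𝟙 (r zero ≟ℕ 0) + (∣ zeroSet (r ∘ suc) ∣ + 𝟙 (t ≟ℕ 0))
    ≡⟨ +-assoc (𝟙 (r zero ≟ℕ 0)) _ _ ⟨
  (𝟙 (r zero ≟ℕ 0) + ∣ zeroSet (r ∘ suc) ∣) + 𝟙 (t ≟ℕ 0)
    ≡⟨ cong (_+ 𝟙 (t ≟ℕ 0)) (∣does∷∣ (r zero ≟ℕ 0) (zeroSet (r ∘ suc))) ⟨
  ∣ zeroSet r ∣ + 𝟙 (t ≟ℕ 0) ∎
  where open ≡-Reasoning

∣zeroSet-grow∣ : (r : Ranking m) (t : ℕ) → ∣ zeroSet (grow r t) ∣ ≡ ∣ zeroSet r ∣ + 𝟙 (t ≟ℕ 0)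
∣zeroSet-grow∣ r t =
  trans (∣zeroSet-extend∣ (λ u → 2 * r u) t) (cong (λ p → ∣ p ∣ + 𝟙 (t ≟ℕ 0)) zeroSet-double)
  where
  zeroSet-double : zeroSet (λ u → 2 * r u) ≡ zeroSet r
  zeroSet-double = tabulate-cong λ u →
    does-⇔ (mk⇔ (*-cancelˡ-≡ (r u) 0 2) (cong (2 *_))) (2 * r u ≟ℕ 0) (r u ≟ℕ 0)

∣zeroSet-grow-0∣ : (r : Ranking m) → ∣ zeroSet (grow r 0) ∣ ≡ suc ∣ zeroSet r ∣
∣zeroSet-grow-0∣ r = trans (∣zeroSet-grow∣ r 0) (+-comm _ 1)

∣zeroSet-grow-suc∣ : (r : Ranking m) (t : ℕ) → ∣ zeroSet (grow r (suc t)) ∣ ≡ ∣ zeroSet r ∣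
∣zeroSet-grow-suc∣ r t = trans (∣zeroSet-grow∣ r (suc t)) (+-identityʳ _)

WithoutEdgeBound : (K m E : ℕ) → List (Edge m) → Set
WithoutEdgeBound K m E rest =
  ∃ λ r → ForestRanking rest r × 7 * suc ∣ zeroSet r ∣ + m ≤ 2 * E + K

WithoutEdgeBound-↭ : ∀ {K E} {xs ys : List (Edge m)} → xs ↭ ys →
                     WithoutEdgeBound K m E xs → WithoutEdgeBound K m E ys
WithoutEdgeBound-↭ xs↭ys (r , forest , h) = r , forest-↭ xs↭ys forest , h

record FVSBound (K m : ℕ) (es : List (Edge m)) : Set where
  field
    throughVertex : ∀ v → ∃ λ r → r v ≡ 0 × ForestRanking es r ×
                                  7 * ∣ zeroSet r ∣ + m ≤ 2 * length es + K
    withoutEdge   : ∀ {e rest} → es ↭ e ∷ rest → WithoutEdgeBound K m (length es) rest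

FVSBound-↭ : ∀ {K} {es es′ : List (Edge m)} → es ↭ es′ → FVSBound K m es → FVSBound K m es′
FVSBound-↭ {m} {K} es↭es′ B = record
  { throughVertex = λ v → let r , rv≡0 , forest , h = throughVertex v in
      r , rv≡0 , forest-↭ es↭es′ forest ,
      subst (λ E → 7 * ∣ zeroSet r ∣ + m ≤ 2 * E + K) (↭.↭-length es↭es′) h
  ; withoutEdge = λ es′↭ → let r , forest , h = withoutEdge (↭-trans es↭es′ es′↭) in
      r , forest , subst (λ E → 7 * suc ∣ zeroSet r ∣ + m ≤ 2 * E + K) (↭.↭-length es↭es′) h
  }
  where open FVSBound B

FVSBound-mono : ∀ {K K′} {es : List (Edge m)} → K ≤ K′ → FVSBound K m es → FVSBound K′ m es
FVSBound-mono K≤K′ B = record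
  { throughVertex = λ v → let r , rv≡0 , forest , h = throughVertex v in
      r , rv≡0 , forest , ≤-trans h (+-monoʳ-≤ _ K≤K′)
  ; withoutEdge = λ es↭ → let r , forest , h = withoutEdge es↭ in
      r , forest , ≤-trans h (+-monoʳ-≤ _ K≤K′)
  }
  where open FVSBound B

lifted-removal : ∀ (N : List (Edge (suc m))) {e M M₀} → M ↭ e ∷ M₀ →
                 N ++ map liftEdge M ↭ liftEdge e ∷ N ++ map liftEdge M₀
lifted-removal N {e} {M₀ = M₀} M↭ =
  ↭-trans (↭.++⁺ˡ N (↭.map⁺ liftEdge M↭)) (↭.shift (liftEdge e) N (map liftEdge M₀))

subdivision-arith : ∀ {c m E K} → 7 * c + m ≤ 2 * suc E + suc K → 7 * c + suc m ≤ 2 * suc (suc E) + K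
subdivision-arith {c} {m} {E} {K} h = begin
  7 * c + suc m           ≡⟨ +-suc (7 * c) m ⟩
  suc (7 * c + m)         ≤⟨ s≤s h ⟩
  suc (2 * suc E + suc K) ≡⟨ regroup E K ⟩
  2 * suc (suc E) + K     ∎
  where
  open ≤-Reasoning
  regroup : ∀ E K → suc (2 * suc E + suc K) ≡ 2 * suc (suc E) + K
  regroup = solve-∀

attachment-arith : ∀ {c m E K} → 7 * c + m ≤ 2 * E + K → 7 * suc c + suc m ≤ 2 * (3 + E) + (2 + K)
attachment-arith {c} {m} {E} {K} h = begin
  7 * suc c + suc m      ≡⟨ regroupˡ c m ⟩
  (7 * c + m) + 8        ≤⟨ +-monoˡ-≤ 8 h ⟩
  (2 * E + K) + 8        ≡⟨ regroupʳ E K ⟩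
  2 * (3 + E) + (2 + K)  ∎
  where
  open ≤-Reasoning
  regroupˡ : ∀ c m → 7 * suc c + suc m ≡ (7 * c + m) + 8
  regroupˡ = solve-∀
  regroupʳ : ∀ E K → (2 * E + K) + 8 ≡ 2 * (3 + E) + (2 + K)
  regroupʳ = solve-∀

subdivide-bound : ∀ {K} {p q : Fin m} {M : List (Edge m)} →
                  FVSBound (suc K) m ((p , q) ∷ M) → FVSBound K (suc m) (subdivision p q M)
subdivide-bound {m} {K} {p} {q} {M} B = record
  { throughVertex = through
  ; withoutEdge   = every-removal (WithoutEdgeBound-↭ {K = K} {E′}) without
  }
  where
  open FVSBound B
  E′ = length (subdivision p q M)

  bound : ∀ {c c′} → c′ ≡ c → 7 * c + m ≤ 2 * suc (length M) + suc K →
          7 * c′ + suc m ≤ 2 * E′ + K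
  bound {c} refl h = subst (λ E → 7 * c + suc m ≤ 2 * E + K) (sym (cong (2 +_) (length-map liftEdge M)))
                           (subdivision-arith {c} {m} {length M} {K} h)

  through : ∀ v → ∃ λ r → r v ≡ 0 × ForestRanking (subdivision p q M) r ×
                          7 * ∣ zeroSet r ∣ + suc m ≤ 2 * E′ + K
  through v with lastView v
  ... | old u = let r , ru≡0 , forest , h = throughVertex u in
    grow r (midRank (r p) (r q)) , trans (grow-old r _ u) (cong (2 *_) ru≡0) ,
    forest-subdivide forest , bound (∣zeroSet-grow-suc∣ r _) h
  ... | new = let r , forest , h = withoutEdge ↭-refl in
    grow r 0 , grow-new r 0 ,
    forest-addDeleted forest _ (inj₂ (grow-new r 0) ∷ inj₁ (grow-new r 0) ∷ []) ,
    bound (∣zeroSet-grow-0∣ r) h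

  without : ∀ {e} → e ∈ₗ subdivision p q M →
            ∃ λ rest → subdivision p q M ↭ e ∷ rest × WithoutEdgeBound K (suc m) E′ rest
  without (here refl) = let r , forest , h = withoutEdge ↭-refl in
    _ , ↭-refl , grow r 1 , forest-addPendant forest q [] [] , bound (cong suc (∣zeroSet-grow-suc∣ r 0)) h
  without (there (here refl)) = let r , forest , h = withoutEdge ↭-refl in
    _ , swap _ _ ↭-refl , grow r 1 , forest-flip (forest-addPendant forest p [] []) ,
    bound (cong suc (∣zeroSet-grow-suc∣ r 0)) h
  without (there (there e∈))
    with e₀ , e₀∈M , refl ← ∈-map⁻ liftEdge e∈ with M₀ , M↭ ← ∈⇒↭-∷ e₀∈M =
    let r , forest , h = withoutEdge (↭-trans (prep _ M↭) (swap _ _ ↭-refl)) in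
    subdivision p q M₀ , lifted-removal _ M↭ , grow r (midRank (r p) (r q)) , forest-subdivide forest ,
    bound (cong suc (∣zeroSet-grow-suc∣ r _)) h

attachEdges : Fin m → Fin m → Fin m → List (Edge (suc m))
attachEdges {m} a x y =
  (fromℕ m , inject₁ a) ∷ (fromℕ m , inject₁ x) ∷ (fromℕ m , inject₁ y) ∷ []

attachment : Fin m → Fin m → Fin m → List (Edge m) → List (Edge (suc m))
attachment a x y M = attachEdges a x y ++ map liftEdge M

attach-bound : ∀ {K} {M : List (Edge m)} → FVSBound K m M →
               (a x y : Fin m) → FVSBound (2 + K) (suc m) (attachment a x y M)
attach-bound {m} {K} {M} B a x y = record
  { throughVertex = through
  ; withoutEdge   = every-removal (WithoutEdgeBound-↭ {K = 2 + K} {E′}) without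
  }
  where
  open FVSBound B
  s = fromℕ m
  E′ = length (attachment a x y M)

  bound : ∀ {c c′} → c′ ≡ suc c → 7 * c + m ≤ 2 * length M + K →
          7 * c′ + suc m ≤ 2 * E′ + (2 + K)
  bound {c} refl h = subst (λ E → 7 * suc c + suc m ≤ 2 * E + (2 + K))
                           (sym (cong (3 +_) (length-map liftEdge M)))
                           (attachment-arith {c} {m} {length M} {K} h)

  s-deleted : ∀ (r : Ranking m) → All (Dead (grow r 0)) (attachEdges a x y)
  s-deleted r = inj₁ (grow-new r 0) ∷ inj₁ (grow-new r 0) ∷ inj₁ (grow-new r 0) ∷ []

  to-deleted : ∀ (r : Ranking m) {b} → r b ≡ 0 → Dead (grow r 1) (s , inject₁ b)
  to-deleted r {b} rb≡0 = inj₂ (trans (grow-old r 1 b) (cong (2 *_) rb≡0))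

  through : ∀ v → ∃ λ r → r v ≡ 0 × ForestRanking (attachment a x y M) r ×
                          7 * ∣ zeroSet r ∣ + suc m ≤ 2 * E′ + (2 + K)
  through v with lastView v
  ... | old u = let r , ru≡0 , forest , h = throughVertex u in
    grow r 0 , trans (grow-old r 0 u) (cong (2 *_) ru≡0) ,
    forest-addDeleted forest _ (s-deleted r) , bound (∣zeroSet-grow-0∣ r) h
  ... | new = let r , _ , forest , h = throughVertex a in
    grow r 0 , grow-new r 0 , forest-addDeleted forest _ (s-deleted r) , bound (∣zeroSet-grow-0∣ r) h

  without : ∀ {e} → e ∈ₗ attachment a x y M →
            ∃ λ rest → attachment a x y M ↭ e ∷ rest × WithoutEdgeBound (2 + K) (suc m) E′ rest
  without (here refl) = let r , rx≡0 , forest , h = throughVertex x in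
    _ , prep _ (swap _ _ ↭-refl) , grow r 1 , forest-addPendant forest y _ (to-deleted r rx≡0 ∷ []) ,
    bound (cong suc (∣zeroSet-grow-suc∣ r 0)) h
  without (there (here refl)) = let r , ra≡0 , forest , h = throughVertex a in
    _ , ↭-trans (swap _ _ ↭-refl) (prep _ (swap _ _ ↭-refl)) ,
    grow r 1 , forest-addPendant forest y _ (to-deleted r ra≡0 ∷ []) ,
    bound (cong suc (∣zeroSet-grow-suc∣ r 0)) h
  without (there (there (here refl))) = let r , ra≡0 , forest , h = throughVertex a in
    _ , ↭-trans (swap _ _ ↭-refl) (↭-trans (prep _ (swap _ _ ↭-refl)) (swap _ _ ↭-refl)) ,
    grow r 1 , forest-addPendant forest x _ (to-deleted r ra≡0 ∷ []) ,
    bound (cong suc (∣zeroSet-grow-suc∣ r 0)) h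
  without (there (there (there e∈)))
    with e₀ , e₀∈M , refl ← ∈-map⁻ liftEdge e∈ with M₀ , M↭ ← ∈⇒↭-∷ e₀∈M =
    let r , forest , h = withoutEdge M↭ in
    _ , lifted-removal _ M↭ , grow r 0 , forest-addDeleted forest _ (s-deleted r) ,
    bound (cong suc (∣zeroSet-grow-0∣ r)) h

map-liftEdge³ : (R : List (Edge m)) → map liftEdge (map liftEdge (map liftEdge R)) ≡ map Lpair R
map-liftEdge³ []      = refl
map-liftEdge³ (e ∷ R) = cong (Lpair e ∷_) (map-liftEdge³ R)

FVSBound-reverse-blocks : ∀ {K} (X Y Z : List (Edge (3 + m))) (R : List (Edge m)) →
  FVSBound K (3 + m) (Z ++ Y ++ X ++ map liftEdge (map liftEdge (map liftEdge R))) →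
  FVSBound K (3 + m) (X ++ Y ++ Z ++ map Lpair R)
FVSBound-reverse-blocks X Y Z R = FVSBound-↭
  (↭-trans (reverse-blocks X Y Z _) (↭-reflexive (cong (λ T → X ++ Y ++ Z ++ T) (map-liftEdge³ R))))

-- Both forms of G ∘ (e₁ , e₂ , a) subdivide twice and then attach z to a, x and y.
circ-bound : ∀ {K} {G H : Multigraph} → Circ G H →
             FVSBound (2 + K) (n G) (edges G) → FVSBound (2 + K) (n H) (edges H)
circ-bound {G = G} (circ-distinct {p₁} {q₁} {p₂} {q₂} {rest} a _ G↭) B =
  FVSBound-reverse-blocks
    ((L p₁ , Xv) ∷ (Xv , L q₁) ∷ []) ((L p₂ , Yv) ∷ (Yv , L q₂) ∷ []) (attachEdges _ _ _) rest
    (attach-bound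
      (subdivide-bound (FVSBound-↭ (↭.shift _ (_ ∷ _ ∷ []) _) (subdivide-bound (FVSBound-↭ G↭ B))))
      (inject₁ (inject₁ a)) (inject₁ (fromℕ (n G))) (fromℕ (suc (n G))))
circ-bound {G = G} (circ-same {p} {q} {rest} a _ G↭) B =
  FVSBound-reverse-blocks
    ((L p , Xv) ∷ []) ((Xv , Yv) ∷ (Yv , L q) ∷ []) (attachEdges _ _ _) rest
    (attach-bound
      (subdivide-bound (FVSBound-↭ (swap _ _ ↭-refl) (subdivide-bound (FVSBound-↭ G↭ B))))
      (inject₁ (inject₁ a)) (inject₁ (fromℕ (n G))) (fromℕ (suc (n G))))

loop-bound : FVSBound 6 1 ((zero , zero) ∷ [])
loop-bound = record
  { throughVertex = λ _ → (λ _ → 0) , refl , forestRanking (λ _ 0≢0 → contradiction refl 0≢0) , ≤-refl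
  ; withoutEdge   = every-removal (WithoutEdgeBound-↭ {K = 6} {1}) λ where
      (here refl) → [] , ↭-refl , (λ _ → 1) , forestRanking (λ _ _ → z≤n) , ≤-refl
  }

family-bound : ∀ {i j G} → F i j G → FVSBound (2 + (5 ∸ i)) (n G) (edges G)
family-bound F-base = loop-bound
family-bound (F-sub {i = i} f _ (subdivide G↭) _) =
  subdivide-bound (FVSBound-mono (+-monoʳ-≤ 2 (m∸n≤1+m∸1+n 5 i)) (FVSBound-↭ G↭ (family-bound f)))
family-bound (F-circ f _ circ _) = circ-bound circ (family-bound f)

fvs-from-bound : ∀ {K} (G : Multigraph) → FVSBound K (n G) (edges G) → (v : Fin (n G)) →
  (∃ λ S → IsFVS-minus G v S × 7 * ∣ S ∣ + ∣V∣ G + 7 ≤ 2 * ∣E∣ G + K) ×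
  (∃ λ S → v ∈ S × IsFVS G S × 7 * ∣ S ∣ + ∣V∣ G ≤ 2 * ∣E∣ G + K)
fvs-from-bound {K} G B v with FVSBound.throughVertex B v
... | r , rv≡0 , forest , h =
  (S - v , (x∉p-x S v , fvs-minus) , bound-minus) , (S , v∈S , fvs , h)
  where
  S = zeroSet r
  v∈S = rank0⇒∈zeroSet r rv≡0

  fvs : IsFVS G S
  fvs c avoids = cycle-meets-rank0 forest c (λ i ri≡0 → avoids i (rank0⇒∈zeroSet r ri≡0))

  fvs-minus : ∀ c → ¬ AvoidsP c (λ x → x ∈ S - v ⊎ x ≡ v)
  fvs-minus c avoids = cycle-meets-rank0 forest c λ i ri≡0 → avoids i (in-S-v ri≡0)
    where
    in-S-v : ∀ {x} → r x ≡ 0 → x ∈ S - v ⊎ x ≡ v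
    in-S-v {x} rx≡0 with x ≟ v
    ... | yes x≡v = inj₂ x≡v
    ... | no  x≢v = inj₁ (x∈p∧x≢y⇒x∈p-y (rank0⇒∈zeroSet r rx≡0) x≢v)

  bound-minus : 7 * ∣ S - v ∣ + ∣V∣ G + 7 ≤ 2 * ∣E∣ G + K
  bound-minus = begin
    7 * ∣ S - v ∣ + n G + 7    ≡⟨ regroup ∣ S - v ∣ (n G) ⟩
    7 * suc ∣ S - v ∣ + n G    ≤⟨ +-monoˡ-≤ (n G) (*-monoʳ-≤ 7 (x∈p⇒∣p-x∣<∣p∣ v∈S)) ⟩
    7 * ∣ S ∣ + n G            ≤⟨ h ⟩
    2 * ∣E∣ G + K ∎
    where
    open ≤-Reasoning
    regroup : ∀ c V → 7 * c + V + 7 ≡ 7 * suc c + V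
    regroup = solve-∀

lemma3p5 : (i j : ℕ) (G : Multigraph) → 1 ≤ i → j ≤ i → F i j G →
    (v : Fin (n G)) →
      (∃ λ (S : Subset (n G)) → IsFVS-minus G v S ×
          7 * ∣ S ∣ + ∣V∣ G + 7 ≤ 2 * ∣E∣ G + 2 + (5 ∸ i))
      × (∃ λ (S : Subset (n G)) → v ∈ S × IsFVS G S ×
          7 * ∣ S ∣ + ∣V∣ G ≤ 2 * ∣E∣ G + 2 + (5 ∸ i))
lemma3p5 i j G _ _ fG v rewrite +-assoc (2 * ∣E∣ G) 2 (5 ∸ i) = fvs-from-bound G (family-bound fG) v
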